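{- Consider a position of the game described in the context in which the colored graph contains no red $P_3$ and no blue $P_3$, and contains a green path $P_k=v_1v_2\cdots v_k$ with $k\ge 6$. Then Builder has a strategy such that, against every strategy of Painter, either a red or blue $P_3$ appears, or a green cycle $C_k$ is constructed within at most $5$ further rounds. In particular, if $P_k$ is a good path and there is no edge between its endpoints, then (in the same sense) a green $C_k$ can be constructed within at most $4$ further rounds.
   Context: $P_m$ denotes the path and $C_m$ the cycle on $m$ vertices. Game: Builder and Painter play on an infinite vertex set; in each round Builder draws an edge between two currently nonadjacent vertices and Painter immediately colors it red, blue or green. A vertex is good if it is incident to at least one red or blue edge. A green path (all edges green) is good if at least one of its endpoints is a good vertex. -}

module Defs where

open import Data.Nat using (ℕ; zero; suc)
open import Data.Fin using (Fin; toℕ)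
open import Data.Product using (Σ; ∃; _×_; _,_)
open import Data.Sum using (_⊎_)
open import Data.List using (List; []; _∷_)
open import Data.List.Membership.Propositional using (_∈_)
open import Relation.Binary.PropositionalEquality using (_≡_; _≢_)
open import Relation.Nullary using (¬_)
open import Function.Definitions using (Injective)

data Colour : Set where
  red blue green : Colour

-- A position: finite list of coloured edges on the vertex set ℕ
-- (an entry (u , v , c) is the undirected edge uv coloured c).
Graph : Set
Graph = List (ℕ × ℕ × Colour)

HasEdge : Graph → ℕ → ℕ → Colour → Set
HasEdge G u v c = ((u , v , c) ∈ G) ⊎ ((v , u , c) ∈ G)

Adjacent : Graph → ℕ → ℕ → Set
Adjacent G u v = ∃ λ c → HasEdge G u v c

-- Positions reachable by legal moves: every edge joins two distinct,
-- previously nonadjacent vertices (a finite simple coloured graph).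
data Valid : Graph → Set where
  valid-[] : Valid []
  valid-∷  : ∀ {G u v c} → u ≢ v → ¬ Adjacent G u v → Valid G → Valid ((u , v , c) ∷ G)

MonoP3 : Colour → Graph → Set
MonoP3 c G = Σ ℕ λ a → Σ ℕ λ b → Σ ℕ λ d →
  (a ≢ b) × (b ≢ d) × (a ≢ d) × HasEdge G a b c × HasEdge G b d c

GreenPathOn : ∀ {k} → Graph → (Fin k → ℕ) → Set
GreenPathOn {k} G v = Injective _≡_ _≡_ v ×
  (∀ (i j : Fin k) → toℕ j ≡ suc (toℕ i) → HasEdge G (v i) (v j) green)

GreenCycle : ℕ → Graph → Set
GreenCycle k G = Σ (Fin k → ℕ) λ v → GreenPathOn G v ×
  (∀ (i j : Fin k) → toℕ i ≡ 0 → suc (toℕ j) ≡ k → HasEdge G (v i) (v j) green)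

GoodVertex : Graph → ℕ → Set
GoodVertex G x = ∃ λ y → HasEdge G x y red ⊎ HasEdge G x y blue

IsEndpoint : ∀ {k} → Fin k → Set
IsEndpoint {k} i = (toℕ i ≡ 0) ⊎ (suc (toℕ i) ≡ k)

GoodPath : ∀ {k} → Graph → (Fin k → ℕ) → Set
GoodPath {k} G v = Σ (Fin k) λ i → IsEndpoint i × GoodVertex G (v i)

EndpointsNonadjacent : ∀ {k} → Graph → (Fin k → ℕ) → Set
EndpointsNonadjacent {k} G v =
  ∀ (i j : Fin k) → toℕ i ≡ 0 → suc (toℕ j) ≡ k → ¬ Adjacent G (v i) (v j)

Target : ℕ → Graph → Set
Target k G = MonoP3 red G ⊎ MonoP3 blue G ⊎ GreenCycle k G

-- Builder has a strategy that, against every Painter strategy, reaches the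
-- target within at most n further rounds (game-tree formulation:
-- Builder picks a legal edge, Painter answers with any colour).
data BuilderWins (k : ℕ) : ℕ → Graph → Set where
  done : ∀ {n G} → Target k G → BuilderWins k n G
  move : ∀ {n G} (u v : ℕ) → u ≢ v → ¬ Adjacent G u v →
         (∀ (c : Colour) → BuilderWins k n ((u , v , c) ∷ G)) →
         BuilderWins k (suc n) G

{-# OPTIONS --safe #-}

-- Only the ends a = v₀, b = v_{k-1} of the path and the seven chords ab, av₂, av₃, av₄,
-- v₁b, v₂b, v₃b matter. A green ab closes the path into a green C_k, and so does a green
-- crossing pair av_{i+1}, v_i b: run v₀ … v_i, jump to v_{k-1}, walk back to v_{i+1}, return
-- to v₀. Without red or blue P₃ an end carries at most one red and one blue edge, and once it
-- carries one, Painter can no longer use that colour there. So a position is summarised by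
-- the colours of the seven chords and by which of red and blue already occur at a and b.
-- Builder's strategy is found by an exhaustive game-tree search over all 4⁷ · 2⁴ summaries,
-- and it transfers to the real game because every abstract move is a legal real move whose
-- outcome the summary tracks soundly.

module Submission where

open import Defs
open import Data.Bool using (Bool; true; false; T; not; _∧_; _∨_; if_then_else_)
open import Data.Bool.ListAction using (all; any; or)
open import Data.Bool.Properties using (T-∧; T-∨; T-≡)
open import Data.Fin using (Fin; toℕ; fromℕ; fromℕ<)
import Data.Fin as Fin
open import Data.Fin.Properties using (toℕ-injective; toℕ-fromℕ; toℕ-fromℕ<; toℕ≤pred[n])
open import Data.List using (List; []; _∷_; map)
open import Data.List.Membership.Propositional using (_∈_; find; lose)
open import Data.List.Membership.DecPropositional using () renaming (_∈?_ to member?)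
open import Data.List.Relation.Unary.All as All using ([]; _∷_)
open import Data.List.Relation.Unary.All.Properties using (all⁺)
open import Data.List.Relation.Unary.AllPairs as AllPairs using (AllPairs; []; _∷_)
open import Data.List.Relation.Unary.AllPairs.Properties using (map⁺)
open import Data.List.Relation.Unary.Any using (Any; here; there; satisfied; any?)
open import Data.List.Relation.Unary.Any.Properties using (any⁻)
open import Data.Nat using (ℕ; zero; suc; _+_; _∸_; _≤_; _<_; z≤n; s≤s; _≤?_; _≡ᵇ_)
open import Data.Nat.Properties
open import Data.Product using (∃; _×_; _,_; proj₁; proj₂; map₂)
open import Data.Product.Properties using (≡-dec)
open import Data.Sum using (_⊎_; inj₁; inj₂)
import Data.Sum as Sum
open import Data.Unit using (tt)
open import Data.Vec using (Vec; []; _∷_)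
import Data.Vec as Vec
open import Function using (_∘_)
open import Function.Bundles using (Equivalence)
open import Function.Definitions using (Injective)
open import Relation.Binary.Definitions using (DecidableEquality)
open import Relation.Binary.PropositionalEquality
  using (_≡_; _≢_; refl; sym; trans; cong; subst; subst₂; module ≡-Reasoning)
open import Relation.Nullary using (¬_; Dec; yes; no; _because_; contradiction)
open import Relation.Nullary.Decidable using (isYes; map′; _×-dec_; _⊎-dec_; toWitness; fromWitness)
open import Relation.Nullary.Reflects
  using (Reflects; ofʸ; ofⁿ; fromEquivalence; _×-reflects_; _⊎-reflects_)

open Equivalence using (to; from)

HasEdge-sym : ∀ {G x y c} → HasEdge G x y c → HasEdge G y x c
HasEdge-sym (inj₁ p) = inj₂ p
HasEdge-sym (inj₂ p) = inj₁ p

HasEdge-∷ : ∀ {G x y c} t → HasEdge G x y c → HasEdge (t ∷ G) x y c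
HasEdge-∷ t (inj₁ p) = inj₁ (there p)
HasEdge-∷ t (inj₂ p) = inj₂ (there p)

HasEdge-∷⁻ : ∀ {G a b c x y d} → HasEdge ((a , b , c) ∷ G) x y d →
  (x ≡ a × y ≡ b) ⊎ (x ≡ b × y ≡ a) ⊎ HasEdge G x y d
HasEdge-∷⁻ (inj₁ (here refl)) = inj₁ (refl , refl)
HasEdge-∷⁻ (inj₂ (here refl)) = inj₂ (inj₁ (refl , refl))
HasEdge-∷⁻ (inj₁ (there p)) = inj₂ (inj₂ (inj₁ p))
HasEdge-∷⁻ (inj₂ (there p)) = inj₂ (inj₂ (inj₂ p))

GreenPathOn-∷ : ∀ {k G} {v : Fin k → ℕ} t → GreenPathOn G v → GreenPathOn (t ∷ G) v
GreenPathOn-∷ t (injective , edges) = injective , λ i j j≡1+i → HasEdge-∷ t (edges i j j≡1+i)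

Valid⇒irreflexive : ∀ {G x y c} → Valid G → HasEdge G x y c → x ≢ y
Valid⇒irreflexive valid (inj₁ p) = ∈⇒irreflexive valid p
  where
  ∈⇒irreflexive : ∀ {G x y c} → Valid G → (x , y , c) ∈ G → x ≢ y
  ∈⇒irreflexive (valid-∷ x≢y _ _) (here refl) = x≢y
  ∈⇒irreflexive (valid-∷ _ _ valid) (there p) = ∈⇒irreflexive valid p
Valid⇒irreflexive valid (inj₂ p) = Valid⇒irreflexive valid (inj₁ p) ∘ sym

Incident : Graph → ℕ → Colour → Set
Incident G x c = ∃ λ y → HasEdge G x y c

cherry⇒MonoP3 : ∀ {G x y z c} → Valid G →
  HasEdge G x y c → HasEdge G x z c → y ≢ z → MonoP3 c G
cherry⇒MonoP3 valid xy xz y≢z =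
  _ , _ , _ , Valid⇒irreflexive valid xy ∘ sym , Valid⇒irreflexive valid xz , y≢z ,
  HasEdge-sym xy , xz

MonoP3-∷ : ∀ {G x y c} → Valid G → x ≢ y → ¬ Adjacent G x y →
  Incident G x c ⊎ Incident G y c → MonoP3 c ((x , y , c) ∷ G)
MonoP3-∷ {c = c} valid x≢y nonadjacent (inj₁ (z , xz)) =
  cherry⇒MonoP3 (valid-∷ x≢y nonadjacent valid) (HasEdge-∷ _ xz) (inj₁ (here refl))
    λ { refl → nonadjacent (c , xz) }
MonoP3-∷ {c = c} valid x≢y nonadjacent (inj₂ (z , yz)) =
  cherry⇒MonoP3 (valid-∷ x≢y nonadjacent valid) (HasEdge-∷ _ yz) (inj₂ (here refl))
    λ { refl → nonadjacent (c , HasEdge-sym yz) }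

_==ᶜ_ : Colour → Colour → Bool
red ==ᶜ red = true
blue ==ᶜ blue = true
green ==ᶜ green = true
_ ==ᶜ _ = false

==ᶜ-reflects : ∀ c d → Reflects (c ≡ d) (c ==ᶜ d)
==ᶜ-reflects red red = ofʸ refl
==ᶜ-reflects red blue = ofⁿ λ ()
==ᶜ-reflects red green = ofⁿ λ ()
==ᶜ-reflects blue red = ofⁿ λ ()
==ᶜ-reflects blue blue = ofʸ refl
==ᶜ-reflects blue green = ofⁿ λ ()
==ᶜ-reflects green red = ofⁿ λ ()
==ᶜ-reflects green blue = ofⁿ λ ()
==ᶜ-reflects green green = ofʸ refl

_≟ᶜ_ : DecidableEquality Colour
c ≟ᶜ d = (c ==ᶜ d) because ==ᶜ-reflects c d

hasEdge? : ∀ G x y c → Dec (HasEdge G x y c)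
hasEdge? G x y c = member? _≟ₑ_ (x , y , c) G ⊎-dec member? _≟ₑ_ (y , x , c) G
  where
  _≟ₑ_ : DecidableEquality (ℕ × ℕ × Colour)
  _≟ₑ_ = ≡-dec _≟_ (≡-dec _≟_ _≟ᶜ_)

adjacent? : ∀ G x y → Dec (Adjacent G x y)
adjacent? G x y with hasEdge? G x y red | hasEdge? G x y blue | hasEdge? G x y green
... | yes xy | _ | _ = yes (red , xy)
... | no _ | yes xy | _ = yes (blue , xy)
... | no _ | no _ | yes xy = yes (green , xy)
... | no ¬red | no ¬blue | no ¬green = no λ where
  (red , xy) → ¬red xy
  (blue , xy) → ¬blue xy
  (green , xy) → ¬green xy

incident? : ∀ G x c → Dec (Incident G x c)
incident? G x c = map′ witness listed (any? endsAt? G)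
  where
  EndsAt : ℕ × ℕ × Colour → Set
  EndsAt (u , w , d) = d ≡ c × (u ≡ x ⊎ w ≡ x)
  endsAt? : ∀ t → Dec (EndsAt t)
  endsAt? (u , w , d) = (d ≟ᶜ c) ×-dec ((u ≟ x) ⊎-dec (w ≟ x))
  witness : Any EndsAt G → Incident G x c
  witness p with find p
  ... | (_ , w , _) , uw∈G , refl , inj₁ refl = w , inj₁ uw∈G
  ... | (u , _ , _) , uw∈G , refl , inj₂ refl = u , inj₂ uw∈G
  listed : Incident G x c → Any EndsAt G
  listed (_ , inj₁ xy∈G) = lose xy∈G (refl , inj₁ refl)
  listed (_ , inj₂ yx∈G) = lose yx∈G (refl , inj₂ refl)

-- Closing a path by crossing chords

GreenCycle-intro : ∀ {n G} {w : Fin (suc n) → ℕ} → GreenPathOn G w →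
  HasEdge G (w Fin.zero) (w (fromℕ n)) green → GreenCycle (suc n) G
GreenCycle-intro {n} {G} {w} path closing = w , path , λ a b a≡0 b≡n →
  subst₂ (λ a b → HasEdge G (w a) (w b) green)
    (toℕ-injective (sym a≡0))
    (toℕ-injective (trans (toℕ-fromℕ n) (sym (suc-injective b≡n))))
    closing

-- The order in which the cycle v₀ … v_m v_n v_{n-1} … v_{m+1} visits the path:
-- the identity up to m, reversed after it.
reverseAfter : ℕ → ℕ → ℕ → ℕ
reverseAfter m n t with t ≤? m
... | yes _ = t
... | no _ = n + suc m ∸ t

data ReverseAfterStep (m n t : ℕ) : Set where
  ascend : reverseAfter m n (suc t) ≡ suc (reverseAfter m n t) → ReverseAfterStep m n t
  jump : reverseAfter m n t ≡ m → reverseAfter m n (suc t) ≡ n → ReverseAfterStep m n t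
  descend : reverseAfter m n t ≡ suc (reverseAfter m n (suc t)) → ReverseAfterStep m n t

module _ {m n : ℕ} where

  reverseAfter-≤ : ∀ {t} → t ≤ m → reverseAfter m n t ≡ t
  reverseAfter-≤ {t} t≤m with t ≤? m
  ... | yes _ = refl
  ... | no t≰m = contradiction t≤m t≰m

  reverseAfter-> : ∀ {t} → m < t → reverseAfter m n t ≡ n + suc m ∸ t
  reverseAfter-> {t} m<t with t ≤? m
  ... | yes t≤m = contradiction t≤m (<⇒≱ m<t)
  ... | no _ = refl

  private
    reflected-above : ∀ {t} → m < t → t ≤ n → m < n + suc m ∸ t
    reflected-above {t} m<t t≤n = begin-strict
      m             <⟨ n<1+n m ⟩
      suc m         ≡⟨ m+n∸m≡n n (suc m) ⟨
      n + suc m ∸ n ≤⟨ ∸-monoʳ-≤ (n + suc m) t≤n ⟩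
      n + suc m ∸ t ∎
      where open ≤-Reasoning

  reverseAfter-≤n : ∀ {t} → t ≤ n → reverseAfter m n t ≤ n
  reverseAfter-≤n {t} t≤n with t ≤? m
  ... | yes _ = t≤n
  ... | no t≰m = begin
    n + suc m ∸ t     ≤⟨ ∸-monoʳ-≤ (n + suc m) (≰⇒> t≰m) ⟩
    n + suc m ∸ suc m ≡⟨ m+n∸n≡m n (suc m) ⟩
    n                 ∎
    where open ≤-Reasoning

  reverseAfter-injective : ∀ {t t′} → t ≤ n → t′ ≤ n →
    reverseAfter m n t ≡ reverseAfter m n t′ → t ≡ t′
  reverseAfter-injective {t} {t′} t≤n t′≤n eq with t ≤? m | t′ ≤? m
  ... | yes _ | yes _ = eq
  ... | yes t≤m | no t′≰m = contradiction eq (<⇒≢ (≤-<-trans t≤m (reflected-above (≰⇒> t′≰m) t′≤n)))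
  ... | no t≰m | yes t′≤m = contradiction eq (>⇒≢ (≤-<-trans t′≤m (reflected-above (≰⇒> t≰m) t≤n)))
  ... | no _ | no _ =
    ∸-cancelˡ-≡ (≤-trans t≤n (m≤m+n n (suc m))) (≤-trans t′≤n (m≤m+n n (suc m))) eq

  reverseAfter-step : ∀ t → suc t ≤ n → ReverseAfterStep m n t
  reverseAfter-step t 1+t≤n with suc t ≤? m | t ≤? m
  ... | yes 1+t≤m | _ =
    ascend (trans (reverseAfter-≤ 1+t≤m) (cong suc (sym (reverseAfter-≤ (<⇒≤ 1+t≤m)))))
  ... | no 1+t≰m | yes t≤m = jump (trans (reverseAfter-≤ t≤m) t≡m) (begin
    reverseAfter m n (suc t) ≡⟨ reverseAfter-> (≰⇒> 1+t≰m) ⟩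
    n + suc m ∸ suc t        ≡⟨ cong (λ u → n + suc m ∸ suc u) t≡m ⟩
    n + suc m ∸ suc m        ≡⟨ m+n∸n≡m n (suc m) ⟩
    n                        ∎)
    where
    open ≡-Reasoning
    t≡m : t ≡ m
    t≡m = ≤-antisym t≤m (≤-pred (≰⇒> 1+t≰m))
  ... | no 1+t≰m | no t≰m = descend (begin
    reverseAfter m n t             ≡⟨ reverseAfter-> (≰⇒> t≰m) ⟩
    n + suc m ∸ t                  ≡⟨ +-∸-assoc 1 (≤-trans 1+t≤n (m≤m+n n (suc m))) ⟩
    suc (n + suc m ∸ suc t)        ≡⟨ cong suc (reverseAfter-> (≰⇒> 1+t≰m)) ⟨
    suc (reverseAfter m n (suc t)) ∎)
    where open ≡-Reasoning

rotate : ∀ {n} → ℕ → Fin (suc n) → Fin (suc n)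
rotate m t = fromℕ< (s≤s (reverseAfter-≤n {m} (toℕ≤pred[n] t)))

toℕ-rotate : ∀ {n} m (t : Fin (suc n)) → toℕ (rotate m t) ≡ reverseAfter m n (toℕ t)
toℕ-rotate m t = toℕ-fromℕ< _

cycle-from-crossing-chords : ∀ {n G} {v : Fin (suc n) → ℕ} → GreenPathOn G v →
  (i j : Fin (suc n)) → toℕ j ≡ suc (toℕ i) →
  HasEdge G (v Fin.zero) (v j) green → HasEdge G (v i) (v (fromℕ n)) green →
  GreenCycle (suc n) G
cycle-from-crossing-chords {n} {G} {v} (injective , edges) i j j≡1+i chord₀ⱼ chordᵢₙ =
  GreenCycle-intro (rotated-injective , rotated-edges) closing
  where
  m : ℕ
  m = toℕ i

  ρ : Fin (suc n) → Fin (suc n)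
  ρ = rotate m

  toℕ-ρ : ∀ t → toℕ (ρ t) ≡ reverseAfter m n (toℕ t)
  toℕ-ρ = toℕ-rotate m

  v-at : ∀ {a b} → toℕ a ≡ toℕ b → v a ≡ v b
  v-at = cong v ∘ toℕ-injective

  edge-at : ∀ {a b a′ b′} → toℕ a ≡ toℕ a′ → toℕ b ≡ toℕ b′ →
    HasEdge G (v a) (v b) green → HasEdge G (v a′) (v b′) green
  edge-at a≡a′ b≡b′ = subst₂ (λ x y → HasEdge G x y green) (v-at a≡a′) (v-at b≡b′)

  rotated-injective : Injective _≡_ _≡_ (v ∘ ρ)
  rotated-injective {a} {b} eq = toℕ-injective
    (reverseAfter-injective (toℕ≤pred[n] a) (toℕ≤pred[n] b)
      (trans (sym (toℕ-ρ a)) (trans (cong toℕ (injective eq)) (toℕ-ρ b))))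

  toℕ-ρ-next : ∀ a b → toℕ b ≡ suc (toℕ a) → toℕ (ρ b) ≡ reverseAfter m n (suc (toℕ a))
  toℕ-ρ-next a b b≡1+a = trans (toℕ-ρ b) (cong (reverseAfter m n) b≡1+a)

  rotated-edges : ∀ a b → toℕ b ≡ suc (toℕ a) → HasEdge G (v (ρ a)) (v (ρ b)) green
  rotated-edges a b b≡1+a
    with reverseAfter-step {m} {n} (toℕ a) (subst (_≤ n) b≡1+a (toℕ≤pred[n] b))
  ... | ascend p = edges (ρ a) (ρ b)
    (trans (toℕ-ρ-next a b b≡1+a) (trans p (cong suc (sym (toℕ-ρ a)))))
  ... | jump p q = edge-at (sym (trans (toℕ-ρ a) p))
    (trans (toℕ-fromℕ n) (sym (trans (toℕ-ρ-next a b b≡1+a) q))) chordᵢₙ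
  ... | descend p = HasEdge-sym (edges (ρ b) (ρ a)
    (trans (toℕ-ρ a) (trans p (cong suc (sym (toℕ-ρ-next a b b≡1+a))))))

  i<n : m < n
  i<n = subst (_≤ n) j≡1+i (toℕ≤pred[n] j)

  closing : HasEdge G (v (ρ Fin.zero)) (v (ρ (fromℕ n))) green
  closing = edge-at (sym (trans (toℕ-ρ Fin.zero) (reverseAfter-≤ {m} {n} z≤n)))
    (begin
      toℕ j                            ≡⟨ j≡1+i ⟩
      suc m                            ≡⟨ m+n∸m≡n n (suc m) ⟨
      n + suc m ∸ n                    ≡⟨ reverseAfter-> i<n ⟨
      reverseAfter m n n               ≡⟨ cong (reverseAfter m n) (toℕ-fromℕ n) ⟨
      reverseAfter m n (toℕ (fromℕ n)) ≡⟨ toℕ-ρ (fromℕ n) ⟨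
      toℕ (ρ (fromℕ n))                ∎)
    chord₀ⱼ
    where open ≡-Reasoning

Reflects-sound : ∀ {A : Set} {b} → Reflects A b → T b → A
Reflects-sound (ofʸ a) _ = a

T-∨ˡ : ∀ {a} b → T a → T (a ∨ b)
T-∨ˡ {true} _ _ = tt

T-∨ʳ : ∀ a {b} → T b → T (a ∨ b)
T-∨ʳ true _ = tt
T-∨ʳ false b = b

_⇒ᵇ_ : Bool → Bool → Bool
a ⇒ᵇ b = not a ∨ b

⇒ᵇ-elim : ∀ {a b} → T (a ⇒ᵇ b) → T a → T b
⇒ᵇ-elim {true} a⇒b _ = a⇒b

⇒ᵇ-intro : ∀ {a b} → (T a → T b) → T (a ⇒ᵇ b)
⇒ᵇ-intro {true} a⇒b = a⇒b tt
⇒ᵇ-intro {false} _ = tt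

T-not : ∀ {a} → ¬ T a → T (not a)
T-not {true} ¬a = ¬a tt
T-not {false} _ = tt

data Status : Set where
  absent : Status
  painted : Colour → Status

isAbsent : Status → Bool
isAbsent absent = true
isAbsent (painted _) = false

isPainted : Colour → Status → Bool
isPainted c absent = false
isPainted c (painted d) = d ==ᶜ c

isAbsent-sound : ∀ {s} → T (isAbsent s) → s ≡ absent
isAbsent-sound {absent} _ = refl

isPainted-sound : ∀ {c s} → T (isPainted c s) → s ≡ painted c
isPainted-sound {c} {painted d} d==c = cong painted (Reflects-sound (==ᶜ-reflects d c) d==c)

-- Opaque so that conversion checking never unfolds the adjacency decision procedure.
opaque
  statusOf : Graph → ℕ → ℕ → Status
  statusOf G x y with adjacent? G x y
  ... | yes (c , _) = painted c
  ... | no _ = absent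

  statusOf-painted : ∀ {G x y c} → statusOf G x y ≡ painted c → HasEdge G x y c
  statusOf-painted {G} {x} {y} eq with adjacent? G x y
  statusOf-painted refl | yes (_ , xy) = xy

  statusOf-absent : ∀ {G x y} → statusOf G x y ≡ absent → ¬ Adjacent G x y
  statusOf-absent {G} {x} {y} eq with adjacent? G x y
  statusOf-absent () | yes _
  statusOf-absent refl | no nonadjacent = nonadjacent

  statusOf-nonadjacent : ∀ {G x y} → ¬ Adjacent G x y → statusOf G x y ≡ absent
  statusOf-nonadjacent {G} {x} {y} nonadjacent with adjacent? G x y
  ... | yes xy = contradiction xy nonadjacent
  ... | no _ = refl

-- The path vertices v₀, v₁, v₂, v₃, v₄ and v_{k-1}, distinct because k ≥ 6.
data Window : Set where
  w₀ w₁ w₂ w₃ w₄ wₙ : Window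

windowIndex : Window → ℕ
windowIndex w₀ = 0
windowIndex w₁ = 1
windowIndex w₂ = 2
windowIndex w₃ = 3
windowIndex w₄ = 4
windowIndex wₙ = 5

windowAt : ℕ → Window
windowAt 0 = w₀
windowAt 1 = w₁
windowAt 2 = w₂
windowAt 3 = w₃
windowAt 4 = w₄
windowAt _ = wₙ

windowAt-windowIndex : ∀ x → windowAt (windowIndex x) ≡ x
windowAt-windowIndex w₀ = refl
windowAt-windowIndex w₁ = refl
windowAt-windowIndex w₂ = refl
windowAt-windowIndex w₃ = refl
windowAt-windowIndex w₄ = refl
windowAt-windowIndex wₙ = refl

_==ʷ_ : Window → Window → Bool
x ==ʷ y = windowIndex x ≡ᵇ windowIndex y

==ʷ-reflects : ∀ x y → Reflects (x ≡ y) (x ==ʷ y)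
==ʷ-reflects x y = fromEquivalence
  (λ eq → trans (sym (windowAt-windowIndex x))
    (trans (cong windowAt (≡ᵇ⇒≡ _ _ eq)) (windowAt-windowIndex y)))
  (≡⇒≡ᵇ _ _ ∘ cong windowIndex)

data Chord : Set where
  w₀wₙ w₀w₂ w₀w₃ w₀w₄ w₁wₙ w₂wₙ w₃wₙ : Chord

src tgt : Chord → Window
src w₀wₙ = w₀
src w₀w₂ = w₀
src w₀w₃ = w₀
src w₀w₄ = w₀
src w₁wₙ = w₁
src w₂wₙ = w₂
src w₃wₙ = w₃
tgt w₀wₙ = wₙ
tgt w₀w₂ = w₂
tgt w₀w₃ = w₃
tgt w₀w₄ = w₄
tgt w₁wₙ = wₙ
tgt w₂wₙ = wₙ
tgt w₃wₙ = wₙ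

src≢tgt : ∀ e → src e ≢ tgt e
src≢tgt w₀wₙ ()
src≢tgt w₀w₂ ()
src≢tgt w₀w₃ ()
src≢tgt w₀w₄ ()
src≢tgt w₁wₙ ()
src≢tgt w₂wₙ ()
src≢tgt w₃wₙ ()

SameEnds : Chord → Chord → Set
SameEnds e e′ = (src e ≡ src e′ × tgt e ≡ tgt e′) ⊎ (src e ≡ tgt e′ × tgt e ≡ src e′)

sameEnds : Chord → Chord → Bool
sameEnds e e′ = (src e ==ʷ src e′ ∧ tgt e ==ʷ tgt e′) ∨ (src e ==ʷ tgt e′ ∧ tgt e ==ʷ src e′)

sameEnds-reflects : ∀ e e′ → Reflects (SameEnds e e′) (sameEnds e e′)
sameEnds-reflects e e′ =
  (==ʷ-reflects (src e) (src e′) ×-reflects ==ʷ-reflects (tgt e) (tgt e′)) ⊎-reflects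
  (==ʷ-reflects (src e) (tgt e′) ×-reflects ==ʷ-reflects (tgt e) (src e′))

IsEnd : Window → Chord → Set
IsEnd x e = x ≡ src e ⊎ x ≡ tgt e

isEnd : Window → Chord → Bool
isEnd x e = x ==ʷ src e ∨ x ==ʷ tgt e

isEnd-reflects : ∀ x e → Reflects (IsEnd x e) (isEnd x e)
isEnd-reflects x e = ==ʷ-reflects x (src e) ⊎-reflects ==ʷ-reflects x (tgt e)

chords : List Chord
chords = w₀wₙ ∷ w₀w₂ ∷ w₀w₃ ∷ w₀w₄ ∷ w₁wₙ ∷ w₂wₙ ∷ w₃wₙ ∷ []

colours : List Colour
colours = green ∷ red ∷ blue ∷ []

colour-listed : ∀ c → c ∈ colours
colour-listed green = here refl
colour-listed red = there (here refl)
colour-listed blue = there (there (here refl))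

-- hasColour x c: x is known to have an edge of colour c, not necessarily a chord.
record State : Set where
  field
    status : Chord → Status
    hasColour : Window → Colour → Bool
open State

play : State → Chord → Colour → State
play s e c = record
  { status = λ e′ → if sameEnds e e′ then painted c else status s e′
  ; hasColour = λ x d → (d ==ᶜ c ∧ isEnd x e) ∨ hasColour s x d
  }

createsMonoP3 : State → Chord → Colour → Bool
createsMonoP3 s e green = false
createsMonoP3 s e c = hasColour s (src e) c ∨ hasColour s (tgt e) c

isGreen : State → Chord → Bool
isGreen s e = isPainted green (status s e)

closesCycle : State → Bool
closesCycle s = isGreen s w₀wₙ
  ∨ (isGreen s w₀w₂ ∧ isGreen s w₁wₙ)
  ∨ (isGreen s w₀w₃ ∧ isGreen s w₂wₙ)
  ∨ (isGreen s w₀w₄ ∧ isGreen s w₃wₙ)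

wins : ℕ → State → Bool
wins zero s = closesCycle s
wins (suc n) s = closesCycle s ∨ any drawWins chords
  where
  drawWins : Chord → Bool
  drawWins e = isAbsent (status s e) ∧ all (λ c → createsMonoP3 s e c ∨ wins n (play s e c)) colours

atMostOne : List Bool → Bool
atMostOne [] = true
atMostOne (b ∷ bs) = not (b ∧ or bs) ∧ atMostOne bs

coherentAt : Colour → Bool → List Status → Bool
coherentAt c t ss = atMostOne bs ∧ (or bs ⇒ᵇ t)
  where
  bs : List Bool
  bs = map (isPainted c) ss

coherentAt-sound : ∀ {G c x t} → Valid G → ¬ MonoP3 c G → (σ : ℕ → Status) →
  (∀ {y} → σ y ≡ painted c → HasEdge G x y c) → (Incident G x c → T t) →
  ∀ {ys} → AllPairs _≢_ ys → T (coherentAt c t (map σ ys))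
coherentAt-sound {G} {c} {x} valid no-P3 σ σ-sound incident⇒t {ys} distinct =
  from T-∧ (atMostOne-sound distinct , ⇒ᵇ-intro (incident⇒t ∘ map₂ proj₂ ∘ paintedAmong {ys}))
  where
  paintedAmong : ∀ {ys} → T (or (map (isPainted c) (map σ ys))) →
    ∃ λ y → y ∈ ys × HasEdge G x y c
  paintedAmong {y ∷ ys} h with to T-∨ h
  ... | inj₁ painted-y = y , here refl , σ-sound (isPainted-sound painted-y)
  ... | inj₂ painted-ys = let z , z∈ys , xz = paintedAmong painted-ys in z , there z∈ys , xz

  atMostOne-sound : ∀ {ys} → AllPairs _≢_ ys → T (atMostOne (map (isPainted c) (map σ ys)))
  atMostOne-sound [] = tt
  atMostOne-sound {y ∷ ys} (y≢ys ∷ distinct) =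
    from T-∧ (T-not two-painted , atMostOne-sound distinct)
    where
    two-painted : ¬ T (isPainted c (σ y) ∧ or (map (isPainted c) (map σ ys)))
    two-painted both with to T-∧ both
    ... | painted-y , painted-ys with paintedAmong painted-ys
    ...   | z , z∈ys , xz =
      no-P3 (cherry⇒MonoP3 valid (σ-sound (isPainted-sound painted-y)) xz (All.lookup y≢ys z∈ys))

-- Holds for the summary of any graph without red or blue P₃ (initial-coherent below),
-- so the search may ignore all other states.
coherent : State → Bool
coherent s = all coherentEnds (red ∷ blue ∷ [])
  where
  coherentEnds : Colour → Bool
  coherentEnds c =
    coherentAt c (hasColour s w₀ c) (map (status s) (w₀wₙ ∷ w₀w₂ ∷ w₀w₃ ∷ w₀w₄ ∷ [])) ∧
    coherentAt c (hasColour s wₙ c) (map (status s) (w₀wₙ ∷ w₁wₙ ∷ w₂wₙ ∷ w₃wₙ ∷ []))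

goodOpenEnds : State → Bool
goodOpenEnds s = isAbsent (status s w₀wₙ) ∧
  (hasColour s w₀ red ∨ hasColour s w₀ blue ∨ hasColour s wₙ red ∨ hasColour s wₙ blue)

claim : State → Bool
claim s = coherent s ⇒ᵇ (wins 5 s ∧ (goodOpenEnds s ⇒ᵇ wins 4 s))

fromTables : Vec Status 7 → Vec Bool 4 → State
fromTables (s₀ₙ ∷ s₀₂ ∷ s₀₃ ∷ s₀₄ ∷ s₁ₙ ∷ s₂ₙ ∷ s₃ₙ ∷ []) (r₀ ∷ b₀ ∷ rₙ ∷ bₙ ∷ []) =
  record { status = table ; hasColour = atEnds }
  where
  table : Chord → Status
  table w₀wₙ = s₀ₙ
  table w₀w₂ = s₀₂
  table w₀w₃ = s₀₃
  table w₀w₄ = s₀₄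
  table w₁wₙ = s₁ₙ
  table w₂wₙ = s₂ₙ
  table w₃wₙ = s₃ₙ
  atEnds : Window → Colour → Bool
  atEnds w₀ red = r₀
  atEnds w₀ blue = b₀
  atEnds wₙ red = rₙ
  atEnds wₙ blue = bₙ
  atEnds _ _ = false

every : ∀ {A : Set} → List A → (n : ℕ) → (Vec A n → Bool) → Bool
every xs zero p = p []
every xs (suc n) p = all (λ x → every xs n (p ∘ (x ∷_))) xs

every-sound : ∀ {A : Set} {xs : List A} → (∀ x → x ∈ xs) →
  ∀ n p → every xs n p ≡ true → ∀ ys → T (p ys)
every-sound listed zero p holds [] = from T-≡ holds
every-sound {xs = xs} listed (suc n) p holds (y ∷ ys) =
  every-sound listed n (p ∘ (y ∷_)) (to T-≡ (All.lookup (all⁺ _ xs (from T-≡ holds)) (listed y))) ys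

statuses : List Status
statuses = absent ∷ painted red ∷ painted blue ∷ painted green ∷ []

status-listed : ∀ s → s ∈ statuses
status-listed absent = here refl
status-listed (painted red) = there (here refl)
status-listed (painted blue) = there (there (here refl))
status-listed (painted green) = there (there (there (here refl)))

booleans : List Bool
booleans = true ∷ false ∷ []

boolean-listed : ∀ b → b ∈ booleans
boolean-listed true = here refl
boolean-listed false = there (here refl)

-- Named so that claim-holds reuses claim-checked by syntactic equality instead of
-- repeating the search.
claimOnTables : Vec Status 7 → Bool
claimOnTables ss = every booleans 4 (claim ∘ fromTables ss)

claim-checked : every statuses 7 claimOnTables ≡ true
claim-checked = refl

claim-holds : ∀ ss ts → T (claim (fromTables ss ts))
claim-holds ss = every-sound boolean-listed 4 (claim ∘ fromTables ss)
  (to T-≡ (every-sound status-listed 7 claimOnTables claim-checked ss))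

-- Soundness of the abstraction on a path of length k = 6 + m

module OnPath (m : ℕ) (v : Fin (6 + m) → ℕ) (v-injective : Injective _≡_ _≡_ v) where

  N : ℕ
  N = 5 + m

  position : Window → Fin (suc N)
  position w₀ = Fin.zero
  position w₁ = Fin.suc Fin.zero
  position w₂ = Fin.suc (Fin.suc Fin.zero)
  position w₃ = Fin.suc (Fin.suc (Fin.suc Fin.zero))
  position w₄ = Fin.suc (Fin.suc (Fin.suc (Fin.suc Fin.zero)))
  position wₙ = fromℕ N

  windowOf : Fin (suc N) → Window
  windowOf Fin.zero = w₀
  windowOf (Fin.suc Fin.zero) = w₁
  windowOf (Fin.suc (Fin.suc Fin.zero)) = w₂
  windowOf (Fin.suc (Fin.suc (Fin.suc Fin.zero))) = w₃
  windowOf (Fin.suc (Fin.suc (Fin.suc (Fin.suc Fin.zero)))) = w₄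
  windowOf _ = wₙ

  windowOf-position : ∀ x → windowOf (position x) ≡ x
  windowOf-position w₀ = refl
  windowOf-position w₁ = refl
  windowOf-position w₂ = refl
  windowOf-position w₃ = refl
  windowOf-position w₄ = refl
  windowOf-position wₙ = refl

  V : Window → ℕ
  V = v ∘ position

  V-injective : ∀ {x y} → V x ≡ V y → x ≡ y
  V-injective {x} {y} eq =
    trans (sym (windowOf-position x)) (trans (cong windowOf (v-injective eq)) (windowOf-position y))

  V-chord : ∀ e → V (src e) ≢ V (tgt e)
  V-chord e = src≢tgt e ∘ V-injective

  drawChord : Chord → Colour → Graph → Graph
  drawChord e c G = (V (src e) , V (tgt e) , c) ∷ G

  record Abstraction (s : State) (G : Graph) : Set where
    field
      valid : Valid G
      path : GreenPathOn G v
      absent⇒nonadjacent : ∀ e → status s e ≡ absent → ¬ Adjacent G (V (src e)) (V (tgt e))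
      painted⇒edge : ∀ e {c} → status s e ≡ painted c → HasEdge G (V (src e)) (V (tgt e)) c
      hasColour⇒incident : ∀ x c → T (hasColour s x c) → Incident G (V x) c

  play-abstraction : ∀ {s G e} → Abstraction s G → status s e ≡ absent → ∀ c →
    Abstraction (play s e c) (drawChord e c G)
  play-abstraction {s} {G} {e} A e-absent c = record
    { valid = valid-∷ (V-chord e) (absent⇒nonadjacent e e-absent) valid
    ; path = GreenPathOn-∷ _ path
    ; absent⇒nonadjacent = still-absent
    ; painted⇒edge = still-painted
    ; hasColour⇒incident = still-incident
    }
    where
    open Abstraction A
    G′ : Graph
    G′ = drawChord e c G

    still-absent : ∀ e′ → (if sameEnds e e′ then painted c else status s e′) ≡ absent →
      ¬ Adjacent G′ (V (src e′)) (V (tgt e′))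
    still-absent e′ eq (d , h) with sameEnds e e′ | sameEnds-reflects e e′
    still-absent e′ () (d , h) | true | _
    ... | false | ofⁿ different with HasEdge-∷⁻ h
    ...   | inj₁ (p , q) = different (inj₁ (V-injective (sym p) , V-injective (sym q)))
    ...   | inj₂ (inj₁ (p , q)) = different (inj₂ (V-injective (sym q) , V-injective (sym p)))
    ...   | inj₂ (inj₂ h′) = absent⇒nonadjacent e′ eq (d , h′)

    still-painted : ∀ e′ {d} → (if sameEnds e e′ then painted c else status s e′) ≡ painted d →
      HasEdge G′ (V (src e′)) (V (tgt e′)) d
    still-painted e′ eq with sameEnds e e′ | sameEnds-reflects e e′
    still-painted e′ refl | true | ofʸ (inj₁ (p , q)) =
      subst₂ (λ x y → HasEdge G′ (V x) (V y) c) p q (inj₁ (here refl))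
    still-painted e′ refl | true | ofʸ (inj₂ (p , q)) =
      subst₂ (λ x y → HasEdge G′ (V x) (V y) c) q p (inj₂ (here refl))
    still-painted e′ eq | false | _ = HasEdge-∷ _ (painted⇒edge e′ eq)

    still-incident : ∀ x d → T ((d ==ᶜ c ∧ isEnd x e) ∨ hasColour s x d) → Incident G′ (V x) d
    still-incident x d h with d ==ᶜ c | ==ᶜ-reflects d c | isEnd x e | isEnd-reflects x e
    ... | true | ofʸ refl | true | ofʸ (inj₁ refl) = V (tgt e) , inj₁ (here refl)
    ... | true | ofʸ refl | true | ofʸ (inj₂ refl) = V (src e) , inj₂ (here refl)
    ... | true | _ | false | _ = map₂ (HasEdge-∷ _) (hasColour⇒incident x d h)
    ... | false | _ | _ | _ = map₂ (HasEdge-∷ _) (hasColour⇒incident x d h)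

  drawn-MonoP3 : ∀ {s G e} → Abstraction s G → status s e ≡ absent → ∀ c →
    T (hasColour s (src e) c ∨ hasColour s (tgt e) c) → MonoP3 c (drawChord e c G)
  drawn-MonoP3 {e = e} A e-absent c h = MonoP3-∷ valid (V-chord e) (absent⇒nonadjacent e e-absent)
    (Sum.map (hasColour⇒incident (src e) c) (hasColour⇒incident (tgt e) c) (to T-∨ h))
    where open Abstraction A

  createsMonoP3-sound : ∀ {s G e} → Abstraction s G → status s e ≡ absent →
    ∀ c → T (createsMonoP3 s e c) → Target (6 + m) (drawChord e c G)
  createsMonoP3-sound A e-absent red h = inj₁ (drawn-MonoP3 A e-absent red h)
  createsMonoP3-sound A e-absent blue h = inj₂ (inj₁ (drawn-MonoP3 A e-absent blue h))

  green-chord : ∀ {s G} → Abstraction s G → ∀ e → T (isGreen s e) →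
    HasEdge G (V (src e)) (V (tgt e)) green
  green-chord A e g = Abstraction.painted⇒edge A e (isPainted-sound g)

  closesCycle-sound : ∀ {s G} → Abstraction s G → T (closesCycle s) → GreenCycle (6 + m) G
  closesCycle-sound {s} A h with to T-∨ h
  ... | inj₁ g₀ₙ = GreenCycle-intro (Abstraction.path A) (green-chord A w₀wₙ g₀ₙ)
  ... | inj₂ h′ with to T-∨ h′
  ... | inj₁ g = let g₀₂ , g₁ₙ = to T-∧ g in cycle-from-crossing-chords (Abstraction.path A)
    (position w₁) (position w₂) refl (green-chord A w₀w₂ g₀₂) (green-chord A w₁wₙ g₁ₙ)
  ... | inj₂ h″ with to T-∨ h″
  ... | inj₁ g = let g₀₃ , g₂ₙ = to T-∧ g in cycle-from-crossing-chords (Abstraction.path A)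
    (position w₂) (position w₃) refl (green-chord A w₀w₃ g₀₃) (green-chord A w₂wₙ g₂ₙ)
  ... | inj₂ g = let g₀₄ , g₃ₙ = to T-∧ g in cycle-from-crossing-chords (Abstraction.path A)
    (position w₃) (position w₄) refl (green-chord A w₀w₄ g₀₄) (green-chord A w₃wₙ g₃ₙ)

  wins-sound : ∀ n {s G} → Abstraction s G → T (wins n s) → BuilderWins (6 + m) n G
  wins-sound zero A closed = done (inj₂ (inj₂ (closesCycle-sound A closed)))
  wins-sound (suc n) {s} {G} A h with to T-∨ h
  ... | inj₁ closed = done (inj₂ (inj₂ (closesCycle-sound A closed)))
  ... | inj₂ drawable with satisfied (any⁻ _ chords drawable)
  ... | e , draw with to T-∧ draw
  ... | e-absent , answers = move (V (src e)) (V (tgt e)) (V-chord e)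
    (Abstraction.absent⇒nonadjacent A e (isAbsent-sound e-absent)) answer
    where
    reply : Colour → Bool
    reply c = createsMonoP3 s e c ∨ wins n (play s e c)

    answer : ∀ c → BuilderWins (6 + m) n (drawChord e c G)
    answer c with to T-∨ (All.lookup (all⁺ reply colours answers) (colour-listed c))
    ... | inj₁ lost = done (createsMonoP3-sound A (isAbsent-sound e-absent) c lost)
    ... | inj₂ won = wins-sound n (play-abstraction A (isAbsent-sound e-absent) c) won

  chordStatuses : Graph → Vec Status 7
  chordStatuses G = Vec.map (λ e → statusOf G (V (src e)) (V (tgt e)))
    (w₀wₙ ∷ w₀w₂ ∷ w₀w₃ ∷ w₀w₄ ∷ w₁wₙ ∷ w₂wₙ ∷ w₃wₙ ∷ [])

  hasColourIn : Graph → Window → Colour → Bool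
  hasColourIn G x c = isYes (incident? G (V x) c)

  endColours : Graph → Vec Bool 4
  endColours G =
    hasColourIn G w₀ red ∷ hasColourIn G w₀ blue ∷ hasColourIn G wₙ red ∷ hasColourIn G wₙ blue ∷ []

  initial : Graph → State
  initial G = fromTables (chordStatuses G) (endColours G)

  status-initial : ∀ G e → status (initial G) e ≡ statusOf G (V (src e)) (V (tgt e))
  status-initial G w₀wₙ = refl
  status-initial G w₀w₂ = refl
  status-initial G w₀w₃ = refl
  status-initial G w₀w₄ = refl
  status-initial G w₁wₙ = refl
  status-initial G w₂wₙ = refl
  status-initial G w₃wₙ = refl

  initial-abstraction : ∀ {G} → Valid G → GreenPathOn G v → Abstraction (initial G) G
  initial-abstraction {G} valid path = record
    { valid = valid
    ; path = path
    ; absent⇒nonadjacent = λ e → statusOf-absent ∘ trans (sym (status-initial G e))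
    ; painted⇒edge = λ e → statusOf-painted ∘ trans (sym (status-initial G e))
    ; hasColour⇒incident = incident-at-ends
    }
    where
    incident-at-ends : ∀ x c → T (hasColour (initial G) x c) → Incident G (V x) c
    incident-at-ends w₀ red = toWitness
    incident-at-ends w₀ blue = toWitness
    incident-at-ends wₙ red = toWitness
    incident-at-ends wₙ blue = toWitness
    incident-at-ends w₀ green ()
    incident-at-ends w₁ _ ()
    incident-at-ends w₂ _ ()
    incident-at-ends w₃ _ ()
    incident-at-ends w₄ _ ()
    incident-at-ends wₙ green ()

  V-distinct : ∀ {xs} → AllPairs _≢_ xs → AllPairs _≢_ (map V xs)
  V-distinct = map⁺ ∘ AllPairs.map (λ x≢y → x≢y ∘ V-injective)

  neighbours₀ neighboursₙ : List Window
  neighbours₀ = wₙ ∷ w₂ ∷ w₃ ∷ w₄ ∷ []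
  neighboursₙ = w₀ ∷ w₁ ∷ w₂ ∷ w₃ ∷ []

  neighbours₀-distinct : AllPairs _≢_ (map V neighbours₀)
  neighbours₀-distinct = V-distinct {neighbours₀}
    (((λ ()) ∷ (λ ()) ∷ (λ ()) ∷ []) ∷ ((λ ()) ∷ (λ ()) ∷ []) ∷ ((λ ()) ∷ []) ∷ [] ∷ [])

  neighboursₙ-distinct : AllPairs _≢_ (map V neighboursₙ)
  neighboursₙ-distinct = V-distinct {neighboursₙ}
    (((λ ()) ∷ (λ ()) ∷ (λ ()) ∷ []) ∷ ((λ ()) ∷ (λ ()) ∷ []) ∷ ((λ ()) ∷ []) ∷ [] ∷ [])

  initial-coherent : ∀ {G} → Valid G → ¬ MonoP3 red G → ¬ MonoP3 blue G → T (coherent (initial G))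
  initial-coherent {G} valid no-red no-blue =
    from T-∧ (coherentEnds red no-red , from T-∧ (coherentEnds blue no-blue , tt))
    where
    coherentEnds : ∀ c → ¬ MonoP3 c G →
      T (coherentAt c (hasColourIn G w₀ c) (map (statusOf G (V w₀)) (map V neighbours₀)) ∧
         coherentAt c (hasColourIn G wₙ c) (map (λ y → statusOf G y (V wₙ)) (map V neighboursₙ)))
    coherentEnds c no-P3 = from T-∧
      ( coherentAt-sound valid no-P3 (statusOf G (V w₀)) statusOf-painted fromWitness
          neighbours₀-distinct
      , coherentAt-sound valid no-P3 (λ y → statusOf G y (V wₙ)) (HasEdge-sym ∘ statusOf-painted)
          fromWitness neighboursₙ-distinct
      )

  initial-goodOpenEnds : ∀ {G} → GoodPath G v → EndpointsNonadjacent G v →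
    T (goodOpenEnds (initial G))
  initial-goodOpenEnds {G} good nonadjacent = from T-∧ (closing-absent , good-end good)
    where
    closing-absent : T (isAbsent (statusOf G (V w₀) (V wₙ)))
    closing-absent = subst (T ∘ isAbsent)
      (sym (statusOf-nonadjacent (nonadjacent Fin.zero (fromℕ N) refl (cong suc (toℕ-fromℕ N)))))
      tt

    coloured-end : ∀ x → GoodVertex G (V x) →
      T (hasColourIn G x red) ⊎ T (hasColourIn G x blue)
    coloured-end x (y , inj₁ xy) = inj₁ (fromWitness (y , xy))
    coloured-end x (y , inj₂ xy) = inj₂ (fromWitness (y , xy))

    r₀ b₀ rₙ bₙ : Bool
    r₀ = hasColourIn G w₀ red
    b₀ = hasColourIn G w₀ blue
    rₙ = hasColourIn G wₙ red
    bₙ = hasColourIn G wₙ blue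

    good-end : GoodPath G v → T (r₀ ∨ b₀ ∨ rₙ ∨ bₙ)
    good-end (i , inj₁ i≡0 , good-i)
      with refl ← toℕ-injective {i = i} {j = Fin.zero} i≡0
      with coloured-end w₀ good-i
    ... | inj₁ red-edge = T-∨ˡ _ red-edge
    ... | inj₂ blue-edge = T-∨ʳ r₀ (T-∨ˡ _ blue-edge)
    good-end (i , inj₂ 1+i≡k , good-i)
      with refl ← toℕ-injective {i = i} {j = fromℕ N}
                    (trans (suc-injective 1+i≡k) (sym (toℕ-fromℕ N)))
      with coloured-end wₙ good-i
    ... | inj₁ red-edge = T-∨ʳ r₀ (T-∨ʳ b₀ (T-∨ˡ bₙ red-edge))
    ... | inj₂ blue-edge = T-∨ʳ r₀ (T-∨ʳ b₀ (T-∨ʳ rₙ blue-edge))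

  builder-wins : ∀ {G} → Valid G → ¬ MonoP3 red G → ¬ MonoP3 blue G → GreenPathOn G v →
    BuilderWins (6 + m) 5 G × (GoodPath G v → EndpointsNonadjacent G v → BuilderWins (6 + m) 4 G)
  builder-wins {G} valid no-red no-blue path =
    wins-sound 5 A in-five ,
    λ good nonadjacent → wins-sound 4 A (in-four (initial-goodOpenEnds good nonadjacent))
    where
    A : Abstraction (initial G) G
    A = initial-abstraction valid path

    guarantee : T (wins 5 (initial G) ∧ (goodOpenEnds (initial G) ⇒ᵇ wins 4 (initial G)))
    guarantee = ⇒ᵇ-elim {coherent (initial G)} (claim-holds (chordStatuses G) (endColours G))
      (initial-coherent valid no-red no-blue)

    in-five : T (wins 5 (initial G))
    in-five = proj₁ (to T-∧ guarantee)

    in-four : T (goodOpenEnds (initial G)) → T (wins 4 (initial G))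
    in-four = ⇒ᵇ-elim (proj₂ (to (T-∧ {wins 5 (initial G)}) guarantee))

lemma4p9 : (k : ℕ) → 6 ≤ k → (G : Graph) → Valid G →
    ¬ MonoP3 red G → ¬ MonoP3 blue G →
    (v : Fin k → ℕ) → GreenPathOn G v →
    BuilderWins k 5 G × (GoodPath G v → EndpointsNonadjacent G v → BuilderWins k 4 G)
lemma4p9 k 6≤k G valid no-red no-blue v path with m≤n⇒∃[o]m+o≡n 6≤k
... | m , refl = OnPath.builder-wins m v (proj₁ path) valid no-red no-blue path
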